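{- Let $\mathbf{Q}=(L,Q_1,\ldots,Q_n,R)$ be a $(4,2)$-flexipath in a matroid $M$ with $n\ge 2$, and assume $\mathbf{Q}$ has no specially placed steps of type (S1). If $\sqcap(L,Q_i)=2$ for some $i\in[n]$, then $\sqcap(L,R)=3$ and $\sqcap(L,Q_j)=2=\sqcap(R,Q_j)$ for all $j\in[n]$.
   Context: Let $M$ be a matroid on ground set $E$ with rank function $r$. $\lambda(A)=r(A)+r(E-A)-r(M)$; for disjoint $X,Y$, $\sqcap(X,Y)=r(X)+r(Y)-r(X\cup Y)$; $\kappa(X,Y)=\min\{\lambda(Z):X\subseteq Z\subseteq E-Y\}$. A path of $4$-separations is an ordered partition $(L,P_1,\ldots,P_n,R)$ of $E$ with $\kappa(L,R)=3$ and $\lambda(L\cup P_1\cup\cdots\cup P_i)=3$ for all $i\in\{0,\ldots,n\}$; a $4$-flexipath if this holds for every reordering of $P_1,\ldots,P_n$ (with $L,R$ fixed); a $(4,2)$-flexipath if moreover $\lambda(P_i)=2$ for all $i$ and $\lambda(P_i\cup P_j)>2$ for all distinct $i,j$. A step $Q_i$ is a specially placed step of type (S1) if $\sqcap(L,R)=2$ and $\sqcap(L,Q_i)=2=\sqcap(R,Q_i)$. -}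

module Defs where

open import Data.Nat using (ℕ; zero; suc; _+_; _∸_; _≤_; _<_)
open import Data.Fin using (Fin; zero; suc)
open import Data.Fin.Subset using (Subset; _∪_; _∩_; ∁; ⊥; ⊤; _⊆_; ∣_∣; Empty)
open import Data.Fin.Permutation using (Permutation′; _⟨$⟩ʳ_)
open import Data.Product using (Σ; _×_; ∃)
open import Relation.Binary.PropositionalEquality using (_≡_)
open import Relation.Nullary using (¬_)
open import Function using (_∘_)

record Matroid (m : ℕ) : Set where
  field
    r         : Subset m → ℕ
    r-bound   : ∀ X → r X ≤ ∣ X ∣
    r-mono    : ∀ X Y → X ⊆ Y → r X ≤ r Y
    r-submod  : ∀ X Y → r (X ∪ Y) + r (X ∩ Y) ≤ r X + r Y

module _ {m : ℕ} (M : Matroid m) where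
  open Matroid M

  rM : ℕ
  rM = r ⊤

  -- connectivity function λ(A) = r(A) + r(E - A) - r(M)  (always ≥ 0)
  λ' : Subset m → ℕ
  λ' A = r A + r (∁ A) ∸ rM

  -- local connectivity ⊓(X,Y) = r(X) + r(Y) - r(X ∪ Y)  (always ≥ 0)
  ⊓ : Subset m → Subset m → ℕ
  ⊓ X Y = r X + r Y ∸ r (X ∪ Y)

  κ≡ : Subset m → Subset m → ℕ → Set
  κ≡ X Y k =
    Σ (Subset m) (λ Z → X ⊆ Z × Z ⊆ ∁ Y × λ' Z ≡ k)
    × (∀ Z → X ⊆ Z → Z ⊆ ∁ Y → k ≤ λ' Z)

prefixUnion : ∀ {m n} → (Fin n → Subset m) → ℕ → Subset m
prefixUnion {n = zero}  P k       = ⊥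
prefixUnion {n = suc n} P zero    = ⊥
prefixUnion {n = suc n} P (suc k) = P zero ∪ prefixUnion (P ∘ suc) k

Disjoint : ∀ {m} → Subset m → Subset m → Set
Disjoint X Y = Empty (X ∩ Y)

IsOrderedPartition : ∀ {m n} → Subset m → (Fin n → Subset m) → Subset m → Set
IsOrderedPartition {m} {n} L P R =
  Disjoint L R
  × (∀ i → Disjoint L (P i))
  × (∀ i → Disjoint (P i) R)
  × (∀ i j → ¬ i ≡ j → Disjoint (P i) (P j))
  × (⊤ ⊆ (L ∪ prefixUnion P n) ∪ R)

module _ {m : ℕ} (M : Matroid m) where

  IsPath4 : ∀ {n} → Subset m → (Fin n → Subset m) → Subset m → Set
  IsPath4 {n} L P R =
    IsOrderedPartition L P R
    × κ≡ M L R 3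
    × (∀ k → k ≤ n → λ' M (L ∪ prefixUnion P k) ≡ 3)

  Is4Flexipath : ∀ {n} → Subset m → (Fin n → Subset m) → Subset m → Set
  Is4Flexipath {n} L P R =
    ∀ (σ : Permutation′ n) → IsPath4 L (λ i → P (σ ⟨$⟩ʳ i)) R

  Is42Flexipath : ∀ {n} → Subset m → (Fin n → Subset m) → Subset m → Set
  Is42Flexipath {n} L P R =
    Is4Flexipath L P R
    × (∀ i → λ' M (P i) ≡ 2)
    × (∀ i j → ¬ i ≡ j → 2 < λ' M (P i ∪ P j))

  IsSpeciallyPlacedS1 : ∀ {n} → Subset m → (Fin n → Subset m) → Subset m → Fin n → Set
  IsSpeciallyPlacedS1 L Q R i =
    ⊓ M L R ≡ 2 × ⊓ M L (Q i) ≡ 2 × ⊓ M R (Q i) ≡ 2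

{-# OPTIONS --safe #-}
module Submission where

-- Everything follows from submodularity through three facts about pairwise disjoint sets:
-- ⊓(X,C) ≤ λ(C); the exchange identity λ(A) + ⊓(B, E − (A ∪ B)) = λ(A ∪ B) + ⊓(B,A), both
-- sides being r(A) + r(B) + r(E − (A ∪ B)) − r(M); and ⊓(X,Z) + ⊓(Y,Z) ≤ λ(Z) + ⊓(X,Y).
-- Reordering the steps shows that L, R, L ∪ Q_j and Q_i ∪ R all have λ = 3.  For C = Q_i the
-- exchange identity with λ(R) = λ(C ∪ R) gives ⊓(R,C) ≥ ⊓(L,C) = 2 = λ(C), and the third fact
-- then gives ⊓(L,R) ≥ 2; since ⊓(L,R) ≤ λ(R) = 3 and ⊓(L,R) = 2 would make Q_i a specially
-- placed step of type (S1), ⊓(L,R) = 3.  For any step C = Q_j, the exchange identity with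
-- ⊓(L,R) = 3 = λ(L ∪ C) and the third fact with ⊓(L,R) = λ(L) force ⊓(L,C) = 2 = ⊓(R,C).

open import Defs
open import Data.Nat using (ℕ; zero; suc; _+_; _∸_; _≤_; _<_; z≤n; s≤s)
open import Data.Nat.Properties
  using ( ≤-refl; ≤-reflexive; ≤-trans; ≤-antisym; <-irrefl; ≤∧≢⇒<; n≤1+n; m≤m+n
        ; m∸n+n≡m; +-assoc; +-comm; +-mono-≤; +-monoˡ-≤; +-monoʳ-≤
        ; +-cancelˡ-≤; +-cancelʳ-≤; +-cancelʳ-≡; +-commutativeSemigroup; module ≤-Reasoning )
open import Algebra.Properties.CommutativeSemigroup +-commutativeSemigroup
  using (xy∙z≈xz∙y; xy∙z≈x∙zy; x∙yz≈z∙yx; x∙yz≈y∙zx)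
import Algebra.Lattice.Properties.BooleanAlgebra as BooleanAlgebraProperties
open import Data.Fin using (Fin; zero; suc; toℕ; fromℕ)
open import Data.Fin.Properties using (toℕ-fromℕ; toℕ-injective; _≟_)
open import Data.Fin.Subset using (Subset; _∪_; _∩_; ∁; ⊥; _⊆_; _∈_; _∉_)
open import Data.Fin.Subset.Properties
  using ( _∈?_; ∉⊥; ∈⊤; ⊆-trans; ⊆-antisym; p⊆p∪q; q⊆p∪q; p⊆q⇒∁p⊇∁q; p∪∁p≡⊤
        ; ∪-comm; ∪-assoc; ∪-identityʳ; x∈p∪q⁺; x∈p∪q⁻; x∈p∩q⁺; x∈p∩q⁻
        ; x∈∁p⇒x∉p; x∉p⇒x∈∁p; ∪-∩-booleanAlgebra )
open import Data.Fin.Permutation using (_⟨$⟩ʳ_; transpose)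
import Data.Fin.Permutation as Permutation
open import Data.Product using (Σ; ∃; _×_; _,_; proj₁; proj₂; uncurry)
open import Data.Sum using (inj₁; inj₂; [_,_])
open import Data.Empty using (⊥-elim)
open import Function using (_∘_; id)
open import Relation.Binary.PropositionalEquality
  using (_≡_; _≢_; refl; sym; trans; cong; cong₂; subst; module ≡-Reasoning)
open import Relation.Nullary using (¬_; yes; no)
open import Relation.Nullary.Decidable using (dec-true)

module _ {m : ℕ} where

  ∪-lub : ∀ {X Y Z : Subset m} → X ⊆ Z → Y ⊆ Z → X ∪ Y ⊆ Z
  ∪-lub X⊆Z Y⊆Z x∈X∪Y = [ X⊆Z , Y⊆Z ] (x∈p∪q⁻ _ _ x∈X∪Y)

  ∩-glb : ∀ {X Y Z : Subset m} → X ⊆ Y → X ⊆ Z → X ⊆ Y ∩ Z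
  ∩-glb X⊆Y X⊆Z x∈X = x∈p∩q⁺ (X⊆Y x∈X , X⊆Z x∈X)

  ∁-involutive : ∀ (X : Subset m) → ∁ (∁ X) ≡ X
  ∁-involutive = BooleanAlgebraProperties.¬-involutive (∪-∩-booleanAlgebra m)

  Disjoint⇒∉ : ∀ {X Y : Subset m} {x} → Disjoint X Y → x ∈ X → x ∉ Y
  Disjoint⇒∉ X#Y x∈X x∈Y = X#Y (_ , x∈p∩q⁺ (x∈X , x∈Y))

  ∉⇒Disjoint : ∀ {X Y : Subset m} → (∀ {x} → x ∈ X → x ∉ Y) → Disjoint X Y
  ∉⇒Disjoint X∌Y (_ , x∈X∩Y) = uncurry X∌Y (x∈p∩q⁻ _ _ x∈X∩Y)

  Disjoint⇒⊆∁ : ∀ {X Y : Subset m} → Disjoint X Y → X ⊆ ∁ Y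
  Disjoint⇒⊆∁ X#Y = x∉p⇒x∈∁p ∘ Disjoint⇒∉ X#Y

  Disjoint-sym : ∀ {X Y : Subset m} → Disjoint X Y → Disjoint Y X
  Disjoint-sym X#Y = ∉⇒Disjoint (λ y∈Y y∈X → Disjoint⇒∉ X#Y y∈X y∈Y)

  Disjoint-∪ˡ : ∀ {X Y Z : Subset m} → Disjoint X Z → Disjoint Y Z → Disjoint (X ∪ Y) Z
  Disjoint-∪ˡ X#Z Y#Z =
    ∉⇒Disjoint (λ x∈X∪Y → [ Disjoint⇒∉ X#Z , Disjoint⇒∉ Y#Z ] (x∈p∪q⁻ _ _ x∈X∪Y))

  Disjoint-∪ʳ : ∀ {X Y Z : Subset m} → Disjoint X Y → Disjoint X Z → Disjoint X (Y ∪ Z)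
  Disjoint-∪ʳ X#Y X#Z = Disjoint-sym (Disjoint-∪ˡ (Disjoint-sym X#Y) (Disjoint-sym X#Z))

  p∪∁[p∪q]≡∁q : ∀ {p q : Subset m} → Disjoint q p → p ∪ ∁ (p ∪ q) ≡ ∁ q
  p∪∁[p∪q]≡∁q {p} {q} q#p = ⊆-antisym
    (∪-lub (Disjoint⇒⊆∁ (Disjoint-sym q#p)) (p⊆q⇒∁p⊇∁q (q⊆p∪q p q)))
    ∁q⊆
    where
    ∁q⊆ : ∁ q ⊆ p ∪ ∁ (p ∪ q)
    ∁q⊆ {x} x∈∁q with x ∈? p
    ... | yes x∈p = x∈p∪q⁺ (inj₁ x∈p)
    ... | no  x∉p = x∈p∪q⁺ (inj₂ (x∉p⇒x∈∁p ([ x∉p , x∈∁p⇒x∉p x∈∁q ] ∘ x∈p∪q⁻ p q)))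

transpose-matchˡ : ∀ {n} (i j : Fin n) → transpose i j ⟨$⟩ʳ i ≡ j
transpose-matchˡ i j rewrite dec-true (i ≟ i) refl = refl

module _ {m : ℕ} where

  prefixUnion-zero : ∀ {n} (P : Fin n → Subset m) → prefixUnion P 0 ≡ ⊥
  prefixUnion-zero {zero}  P = refl
  prefixUnion-zero {suc n} P = refl

  prefixUnion-one : ∀ {n} (P : Fin (suc n) → Subset m) → prefixUnion P 1 ≡ P zero
  prefixUnion-one P = trans (cong (P zero ∪_) (prefixUnion-zero (P ∘ suc))) (∪-identityʳ (P zero))

  ∈prefixUnion⁻ : ∀ {n} (P : Fin n → Subset m) k {x} →
                  x ∈ prefixUnion P k → ∃ λ t → toℕ t < k × x ∈ P t
  ∈prefixUnion⁻ {zero}  P k       x∈ = ⊥-elim (∉⊥ x∈)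
  ∈prefixUnion⁻ {suc n} P zero    x∈ = ⊥-elim (∉⊥ x∈)
  ∈prefixUnion⁻ {suc n} P (suc k) x∈ with x∈p∪q⁻ (P zero) _ x∈
  ... | inj₁ x∈P₀ = zero , s≤s z≤n , x∈P₀
  ... | inj₂ x∈rest with ∈prefixUnion⁻ (P ∘ suc) k x∈rest
  ...   | t , t<k , x∈Pt = suc t , s≤s t<k , x∈Pt

  ∈prefixUnion⁺ : ∀ {n} (P : Fin n → Subset m) {k} t {x} →
                  toℕ t < k → x ∈ P t → x ∈ prefixUnion P k
  ∈prefixUnion⁺ P {suc k} zero    _         x∈ = x∈p∪q⁺ (inj₁ x∈)
  ∈prefixUnion⁺ P {suc k} (suc t) (s≤s t<k) x∈ =
    x∈p∪q⁺ (inj₂ (∈prefixUnion⁺ (P ∘ suc) t t<k x∈))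

  prefixUnion-all : ∀ {n L R} {P : Fin n → Subset m} →
                    IsOrderedPartition L P R → L ∪ prefixUnion P n ≡ ∁ R
  prefixUnion-all {n} {L} {R} {P} (L#R , _ , P#R , _ , cover) = ⊆-antisym
    (∪-lub (Disjoint⇒⊆∁ L#R) prefix⊆∁R)
    (λ x∈∁R → [ id , ⊥-elim ∘ x∈∁p⇒x∉p x∈∁R ] (x∈p∪q⁻ _ R (cover ∈⊤)))
    where
    prefix⊆∁R : prefixUnion P n ⊆ ∁ R
    prefix⊆∁R x∈ = let (t , _ , x∈Pt) = ∈prefixUnion⁻ P n x∈ in Disjoint⇒⊆∁ (P#R t) x∈Pt

  prefixUnion-allButLast : ∀ {n L R} {P : Fin (suc n) → Subset m} →
                           IsOrderedPartition L P R → L ∪ prefixUnion P n ≡ ∁ (P (fromℕ n) ∪ R)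
  prefixUnion-allButLast {n} {L} {R} {P} (L#R , L#P , P#R , P#P , cover) = ⊆-antisym
    (∪-lub (Disjoint⇒⊆∁ (Disjoint-∪ʳ (L#P (fromℕ n)) L#R)) prefix⊆)
    ⊆L∪prefix
    where
    prefix⊆ : prefixUnion P n ⊆ ∁ (P (fromℕ n) ∪ R)
    prefix⊆ x∈ with ∈prefixUnion⁻ P n x∈
    ... | t , t<n , x∈Pt = Disjoint⇒⊆∁ (Disjoint-∪ʳ (P#P t (fromℕ n) t≢last) (P#R t)) x∈Pt
      where
      t≢last : t ≢ fromℕ n
      t≢last t≡last = <-irrefl (trans (cong toℕ t≡last) (toℕ-fromℕ n)) t<n
    ⊆L∪prefix : ∁ (P (fromℕ n) ∪ R) ⊆ L ∪ prefixUnion P n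
    ⊆L∪prefix {x} x∉ with x∈p∪q⁻ _ R (cover ∈⊤)
    ... | inj₂ x∈R = ⊥-elim (x∈∁p⇒x∉p x∉ (x∈p∪q⁺ (inj₂ x∈R)))
    ... | inj₁ x∈L∪P with x∈p∪q⁻ L _ x∈L∪P
    ...   | inj₁ x∈L = x∈p∪q⁺ (inj₁ x∈L)
    ...   | inj₂ x∈P with ∈prefixUnion⁻ P (suc n) x∈P
    ...     | t , s≤s t≤n , x∈Pt = x∈p∪q⁺ (inj₂ (∈prefixUnion⁺ P t (≤∧≢⇒< t≤n t≢n) x∈Pt))
      where
      t≢n : toℕ t ≢ n
      t≢n t≡n = x∈∁p⇒x∉p x∉ (x∈p∪q⁺ (inj₁ (subst (λ u → x ∈ P u) t≡last x∈Pt)))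
        where
        t≡last : t ≡ fromℕ n
        t≡last = toℕ-injective (trans t≡n (sym (toℕ-fromℕ n)))

module _ {m : ℕ} (M : Matroid m) where
  open Matroid M

  r-subadditive : ∀ X Y → r (X ∪ Y) ≤ r X + r Y
  r-subadditive X Y = ≤-trans (m≤m+n _ _) (r-submod X Y)

  r-submod-⊆ : ∀ {U W} X Y → U ⊆ X ∪ Y → W ⊆ X ∩ Y → r U + r W ≤ r X + r Y
  r-submod-⊆ {U} {W} X Y U⊆X∪Y W⊆X∩Y =
    ≤-trans (+-mono-≤ (r-mono U _ U⊆X∪Y) (r-mono W _ W⊆X∩Y)) (r-submod X Y)

  ⊓+r∪≡ : ∀ X Y → ⊓ M X Y + r (X ∪ Y) ≡ r X + r Y
  ⊓+r∪≡ X Y = m∸n+n≡m (r-subadditive X Y)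

  λ+rM≡ : ∀ A → λ' M A + rM M ≡ r A + r (∁ A)
  λ+rM≡ A = m∸n+n≡m (subst (λ E → r E ≤ r A + r (∁ A)) (p∪∁p≡⊤ A) (r-subadditive A (∁ A)))

  ⊓-comm : ∀ X Y → ⊓ M X Y ≡ ⊓ M Y X
  ⊓-comm X Y = cong₂ _∸_ (+-comm (r X) (r Y)) (cong r (∪-comm X Y))

  λ-∁ : ∀ A → λ' M (∁ A) ≡ λ' M A
  λ-∁ A = cong (_∸ rM M)
    (trans (+-comm (r (∁ A)) _) (cong (λ B → r B + r (∁ A)) (∁-involutive A)))

  ⊓-∁≡λ : ∀ A → ⊓ M A (∁ A) ≡ λ' M A
  ⊓-∁≡λ A = cong (λ E → r A + r (∁ A) ∸ r E) (p∪∁p≡⊤ A)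

  ⊓-monoʳ-⊆ : ∀ X {Y Y'} → Y ⊆ Y' → ⊓ M X Y ≤ ⊓ M X Y'
  ⊓-monoʳ-⊆ X {Y} {Y'} Y⊆Y' = +-cancelʳ-≤ (u + v) (⊓ M X Y) (⊓ M X Y') (begin
    ⊓ M X Y + (u + v)    ≡⟨ +-assoc (⊓ M X Y) u v ⟨
    ⊓ M X Y + u + v      ≡⟨ cong (_+ v) (⊓+r∪≡ X Y) ⟩
    r X + r Y + v        ≡⟨ xy∙z≈x∙zy (r X) (r Y) v ⟩
    r X + (v + r Y)      ≤⟨ +-monoʳ-≤ (r X) submod ⟩
    r X + (r Y' + u)     ≡⟨ +-assoc (r X) (r Y') u ⟨
    r X + r Y' + u       ≡⟨ cong (_+ u) (⊓+r∪≡ X Y') ⟨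
    ⊓ M X Y' + v + u     ≡⟨ xy∙z≈x∙zy (⊓ M X Y') v u ⟩
    ⊓ M X Y' + (u + v)   ∎)
    where
    open ≤-Reasoning
    u = r (X ∪ Y)
    v = r (X ∪ Y')
    submod : v + r Y ≤ r Y' + u
    submod = r-submod-⊆ Y' (X ∪ Y)
      (∪-lub (⊆-trans (p⊆p∪q Y) (q⊆p∪q Y' (X ∪ Y))) (p⊆p∪q (X ∪ Y)))
      (∩-glb Y⊆Y' (q⊆p∪q X Y))

  ⊓≤λ : ∀ {X Y} → Disjoint X Y → ⊓ M X Y ≤ λ' M Y
  ⊓≤λ {X} {Y} X#Y = begin
    ⊓ M X Y       ≡⟨ ⊓-comm X Y ⟩
    ⊓ M Y X       ≤⟨ ⊓-monoʳ-⊆ Y (Disjoint⇒⊆∁ X#Y) ⟩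
    ⊓ M Y (∁ Y)   ≡⟨ ⊓-∁≡λ Y ⟩
    λ' M Y        ∎
    where open ≤-Reasoning

  λ+⊓+rM≡ : ∀ {A} B C → B ∪ C ≡ ∁ A → λ' M A + ⊓ M B C + rM M ≡ r A + (r B + r C)
  λ+⊓+rM≡ {A} B C B∪C≡∁A = begin
    λ' M A + ⊓ M B C + rM M      ≡⟨ xy∙z≈xz∙y (λ' M A) (⊓ M B C) (rM M) ⟩
    λ' M A + rM M + ⊓ M B C      ≡⟨ cong (_+ ⊓ M B C) (λ+rM≡ A) ⟩
    r A + r (∁ A) + ⊓ M B C      ≡⟨ cong (λ S → r A + r S + ⊓ M B C) B∪C≡∁A ⟨
    r A + r (B ∪ C) + ⊓ M B C    ≡⟨ xy∙z≈x∙zy (r A) (r (B ∪ C)) (⊓ M B C) ⟩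
    r A + (⊓ M B C + r (B ∪ C))  ≡⟨ cong (r A +_) (⊓+r∪≡ B C) ⟩
    r A + (r B + r C)            ∎
    where open ≡-Reasoning

  λ+⊓-exchange : ∀ {A B} → Disjoint A B →
                 λ' M A + ⊓ M B (∁ (B ∪ A)) ≡ λ' M (B ∪ A) + ⊓ M B A
  λ+⊓-exchange {A} {B} A#B = +-cancelʳ-≡ (rM M) _ _ (begin
    λ' M A + ⊓ M B C + rM M          ≡⟨ λ+⊓+rM≡ B C (p∪∁[p∪q]≡∁q A#B) ⟩
    r A + (r B + r C)                ≡⟨ x∙yz≈z∙yx (r A) (r B) (r C) ⟩
    r C + (r B + r A)                ≡⟨ λ+⊓+rM≡ B A (sym (∁-involutive (B ∪ A))) ⟨
    λ' M C + ⊓ M B A + rM M          ≡⟨ cong (λ k → k + ⊓ M B A + rM M) (λ-∁ (B ∪ A)) ⟩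
    λ' M (B ∪ A) + ⊓ M B A + rM M    ∎)
    where
    open ≡-Reasoning
    C = ∁ (B ∪ A)

  λ+⊓≤λ∪+⊓ : ∀ {A B D} → Disjoint A B → Disjoint D (B ∪ A) →
             λ' M A + ⊓ M B D ≤ λ' M (B ∪ A) + ⊓ M B A
  λ+⊓≤λ∪+⊓ {A} {B} A#B D#B∪A = ≤-trans
    (+-monoʳ-≤ (λ' M A) (⊓-monoʳ-⊆ B (Disjoint⇒⊆∁ D#B∪A)))
    (≤-reflexive (λ+⊓-exchange A#B))

  ⊓-chain : ∀ X Y Z → ⊓ M X (Y ∪ Z) + ⊓ M Y Z ≡ ⊓ M (X ∪ Y) Z + ⊓ M X Y
  ⊓-chain X Y Z = +-cancelʳ-≡ (r (X ∪ (Y ∪ Z))) _ _ (begin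
    ⊓ M X (Y ∪ Z) + ⊓ M Y Z + r (X ∪ (Y ∪ Z))   ≡⟨ total X Y Z ⟩
    r X + (r Y + r Z)                           ≡⟨ x∙yz≈y∙zx (r Z) (r X) (r Y) ⟨
    r Z + (r X + r Y)                           ≡⟨ total Z X Y ⟨
    ⊓ M Z (X ∪ Y) + ⊓ M X Y + r (Z ∪ (X ∪ Y))   ≡⟨ cong₂ (λ k S → k + ⊓ M X Y + r S)
                                                          (⊓-comm Z (X ∪ Y)) Z∪[X∪Y]≡X∪[Y∪Z] ⟩
    ⊓ M (X ∪ Y) Z + ⊓ M X Y + r (X ∪ (Y ∪ Z))   ∎)
    where
    open ≡-Reasoning
    Z∪[X∪Y]≡X∪[Y∪Z] : Z ∪ (X ∪ Y) ≡ X ∪ (Y ∪ Z)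
    Z∪[X∪Y]≡X∪[Y∪Z] = trans (∪-comm Z (X ∪ Y)) (∪-assoc X Y Z)
    total : ∀ X Y Z → ⊓ M X (Y ∪ Z) + ⊓ M Y Z + r (X ∪ (Y ∪ Z)) ≡ r X + (r Y + r Z)
    total X Y Z = begin
      ⊓ M X (Y ∪ Z) + ⊓ M Y Z + r (X ∪ (Y ∪ Z))  ≡⟨ xy∙z≈xz∙y (⊓ M X (Y ∪ Z)) (⊓ M Y Z) _ ⟩
      ⊓ M X (Y ∪ Z) + r (X ∪ (Y ∪ Z)) + ⊓ M Y Z  ≡⟨ cong (_+ ⊓ M Y Z) (⊓+r∪≡ X (Y ∪ Z)) ⟩
      r X + r (Y ∪ Z) + ⊓ M Y Z                  ≡⟨ xy∙z≈x∙zy (r X) (r (Y ∪ Z)) _ ⟩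
      r X + (⊓ M Y Z + r (Y ∪ Z))                ≡⟨ cong (r X +_) (⊓+r∪≡ Y Z) ⟩
      r X + (r Y + r Z)                          ∎

  ⊓+⊓≤λ+⊓ : ∀ {X Y Z} → Disjoint (X ∪ Y) Z → ⊓ M X Z + ⊓ M Y Z ≤ λ' M Z + ⊓ M X Y
  ⊓+⊓≤λ+⊓ {X} {Y} {Z} X∪Y#Z = begin
    ⊓ M X Z + ⊓ M Y Z           ≤⟨ +-monoˡ-≤ (⊓ M Y Z) (⊓-monoʳ-⊆ X (q⊆p∪q Y Z)) ⟩
    ⊓ M X (Y ∪ Z) + ⊓ M Y Z     ≡⟨ ⊓-chain X Y Z ⟩
    ⊓ M (X ∪ Y) Z + ⊓ M X Y     ≤⟨ +-monoˡ-≤ (⊓ M X Y) (⊓≤λ X∪Y#Z) ⟩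
    λ' M Z + ⊓ M X Y            ∎
    where open ≤-Reasoning

  module DisjointTriple {L C R : Subset m}
                        (L#C : Disjoint L C) (C#R : Disjoint C R) (L#R : Disjoint L R) where

    ⊓RC≡λC-byλR : λ' M R ≡ λ' M (C ∪ R) → ⊓ M L C ≡ λ' M C → ⊓ M R C ≡ λ' M C
    ⊓RC≡λC-byλR λR≡λC∪R ⊓LC≡λC = ≤-antisym (⊓≤λ (Disjoint-sym C#R)) (begin
      λ' M C    ≡⟨ trans (sym ⊓LC≡λC) (⊓-comm L C) ⟩
      ⊓ M C L   ≤⟨ +-cancelˡ-≤ (λ' M R) _ _ exchange ⟩
      ⊓ M C R   ≡⟨ ⊓-comm C R ⟩
      ⊓ M R C   ∎)
      where
      open ≤-Reasoning
      exchange : λ' M R + ⊓ M C L ≤ λ' M R + ⊓ M C R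
      exchange = subst (λ k → λ' M R + ⊓ M C L ≤ k + ⊓ M C R) (sym λR≡λC∪R)
        (λ+⊓≤λ∪+⊓ (Disjoint-sym C#R) (Disjoint-∪ʳ L#C L#R))

    λC≤⊓LR : ⊓ M L C ≡ λ' M C → ⊓ M R C ≡ λ' M C → λ' M C ≤ ⊓ M L R
    λC≤⊓LR ⊓LC≡λC ⊓RC≡λC = +-cancelˡ-≤ (λ' M C) _ _ (begin
      λ' M C + λ' M C       ≡⟨ cong₂ _+_ ⊓LC≡λC ⊓RC≡λC ⟨
      ⊓ M L C + ⊓ M R C     ≤⟨ ⊓+⊓≤λ+⊓ (Disjoint-∪ˡ L#C (Disjoint-sym C#R)) ⟩
      λ' M C + ⊓ M L R      ∎)
      where open ≤-Reasoning

    ⊓LC≡λC : ⊓ M L R ≡ λ' M (L ∪ C) → ⊓ M L C ≡ λ' M C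
    ⊓LC≡λC ⊓LR≡λL∪C = ≤-antisym (⊓≤λ L#C) (+-cancelˡ-≤ (λ' M (L ∪ C)) _ _ (begin
      λ' M (L ∪ C) + λ' M C     ≡⟨ +-comm (λ' M (L ∪ C)) (λ' M C) ⟩
      λ' M C + λ' M (L ∪ C)     ≡⟨ cong (λ' M C +_) ⊓LR≡λL∪C ⟨
      λ' M C + ⊓ M L R          ≤⟨ λ+⊓≤λ∪+⊓ (Disjoint-sym L#C)
                                             (Disjoint-sym (Disjoint-∪ˡ L#R C#R)) ⟩
      λ' M (L ∪ C) + ⊓ M L C    ∎))
      where open ≤-Reasoning

    ⊓RC≡λC-by⊓LR : ⊓ M L R ≡ λ' M L → ⊓ M L C ≡ λ' M C → ⊓ M R C ≡ λ' M C
    ⊓RC≡λC-by⊓LR ⊓LR≡λL ⊓LC≡λC =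
      ≤-antisym (⊓≤λ (Disjoint-sym C#R)) (+-cancelˡ-≤ (λ' M L) _ _ (begin
        λ' M L + λ' M C       ≡⟨ cong₂ _+_ (trans (sym ⊓LR≡λL) (⊓-comm L R))
                                           (trans (sym ⊓LC≡λC) (⊓-comm L C)) ⟩
        ⊓ M R L + ⊓ M C L     ≤⟨ ⊓+⊓≤λ+⊓ (Disjoint-sym (Disjoint-∪ʳ L#R L#C)) ⟩
        λ' M L + ⊓ M R C      ∎))
      where open ≤-Reasoning

module Flexipath {m n} (M : Matroid m) {L R : Subset m} {Q : Fin (suc n) → Subset m}
                 (flex : Is4Flexipath M L Q R) where

  private
    λ-prefix : ∀ σ k → k ≤ suc n → λ' M (L ∪ prefixUnion (Q ∘ (σ ⟨$⟩ʳ_)) k) ≡ 3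
    λ-prefix σ = proj₂ (proj₂ (flex σ))

    partition : IsOrderedPartition L Q R
    partition = proj₁ (flex Permutation.id)

  L#R : Disjoint L R
  L#R = proj₁ partition

  L#Q : ∀ j → Disjoint L (Q j)
  L#Q = proj₁ (proj₂ partition)

  Q#R : ∀ j → Disjoint (Q j) R
  Q#R = proj₁ (proj₂ (proj₂ partition))

  λL≡3 : λ' M L ≡ 3
  λL≡3 = subst (λ X → λ' M X ≡ 3) L∪∅≡L (λ-prefix Permutation.id 0 z≤n)
    where
    L∪∅≡L : L ∪ prefixUnion Q 0 ≡ L
    L∪∅≡L = trans (cong (L ∪_) (prefixUnion-zero Q)) (∪-identityʳ L)

  λR≡3 : λ' M R ≡ 3
  λR≡3 = trans (sym (λ-∁ M R))
    (subst (λ X → λ' M X ≡ 3) (prefixUnion-all partition) (λ-prefix Permutation.id (suc n) ≤-refl))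

  λL∪Q≡3 : ∀ j → λ' M (L ∪ Q j) ≡ 3
  λL∪Q≡3 j = subst (λ X → λ' M X ≡ 3) L∪first≡L∪Qj (λ-prefix σ 1 (s≤s z≤n))
    where
    σ = transpose zero j
    L∪first≡L∪Qj : L ∪ prefixUnion (Q ∘ (σ ⟨$⟩ʳ_)) 1 ≡ L ∪ Q j
    L∪first≡L∪Qj = cong (L ∪_)
      (trans (prefixUnion-one (Q ∘ (σ ⟨$⟩ʳ_))) (cong Q (transpose-matchˡ zero j)))

  λQ∪R≡3 : ∀ i → λ' M (Q i ∪ R) ≡ 3
  λQ∪R≡3 i = trans (sym (λ-∁ M (Q i ∪ R)))
    (subst (λ X → λ' M X ≡ 3) L∪init≡∁[Qi∪R] (λ-prefix σ n (n≤1+n n)))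
    where
    σ = transpose (fromℕ n) i
    L∪init≡∁[Qi∪R] : L ∪ prefixUnion (Q ∘ (σ ⟨$⟩ʳ_)) n ≡ ∁ (Q i ∪ R)
    L∪init≡∁[Qi∪R] = trans (prefixUnion-allButLast (proj₁ (flex σ)))
                           (cong (λ t → ∁ (Q t ∪ R)) (transpose-matchˡ (fromℕ n) i))

lemma5p3 : ∀ {m n : ℕ} (M : Matroid m) (L : Subset m) (Q : Fin n → Subset m) (R : Subset m) →
    Is42Flexipath M L Q R →
    2 ≤ n →
    (∀ i → ¬ IsSpeciallyPlacedS1 M L Q R i) →
    Σ (Fin n) (λ i → ⊓ M L (Q i) ≡ 2) →
    ⊓ M L R ≡ 3 × (∀ j → ⊓ M L (Q j) ≡ 2 × ⊓ M R (Q j) ≡ 2)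
lemma5p3 {n = suc n} M L Q R (flex , λQ≡2 , _) _ noS1 (i , ⊓LQi≡2) =
  ⊓LR≡3 , λ j → ⊓LQ≡2 j , ⊓RQ≡2 j
  where
  open Flexipath M {Q = Q} flex
  module Step (j : Fin (suc n)) = DisjointTriple M (L#Q j) (Q#R j) L#R

  ≡λQ : ∀ {X} j → ⊓ M X (Q j) ≡ 2 → ⊓ M X (Q j) ≡ λ' M (Q j)
  ≡λQ j ⊓≡2 = trans ⊓≡2 (sym (λQ≡2 j))

  ⊓RQi≡2 : ⊓ M R (Q i) ≡ 2
  ⊓RQi≡2 = trans (Step.⊓RC≡λC-byλR i (trans λR≡3 (sym (λQ∪R≡3 i))) (≡λQ i ⊓LQi≡2)) (λQ≡2 i)

  ⊓LR≡3 : ⊓ M L R ≡ 3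
  ⊓LR≡3 = ≤-antisym (≤-trans (⊓≤λ M L#R) (≤-reflexive λR≡3)) (≤∧≢⇒< 2≤⊓LR 2≢⊓LR)
    where
    2≤⊓LR : 2 ≤ ⊓ M L R
    2≤⊓LR = subst (_≤ ⊓ M L R) (λQ≡2 i) (Step.λC≤⊓LR i (≡λQ i ⊓LQi≡2) (≡λQ i ⊓RQi≡2))
    2≢⊓LR : 2 ≢ ⊓ M L R
    2≢⊓LR 2≡⊓LR = noS1 i (sym 2≡⊓LR , ⊓LQi≡2 , ⊓RQi≡2)

  ⊓LQ≡2 : ∀ j → ⊓ M L (Q j) ≡ 2
  ⊓LQ≡2 j = trans (Step.⊓LC≡λC j (trans ⊓LR≡3 (sym (λL∪Q≡3 j)))) (λQ≡2 j)

  ⊓RQ≡2 : ∀ j → ⊓ M R (Q j) ≡ 2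
  ⊓RQ≡2 j = trans (Step.⊓RC≡λC-by⊓LR j (trans ⊓LR≡3 (sym λL≡3)) (≡λQ j (⊓LQ≡2 j))) (λQ≡2 j)
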